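{- If $L$ is a BL-algebra of cancellative type, then the monoid $(M_L,+)$ of good sequences of $L$ is cancellative: for all good sequences $\mathbf{a},\mathbf{b},\mathbf{c}$ in $L$, $\mathbf{a}+\mathbf{c}=\mathbf{b}+\mathbf{c}$ implies $\mathbf{a}=\mathbf{b}$.
   Context: A BL-algebra is an algebra $(L,\wedge,\vee,\otimes,\to,0,1)$ such that $(L,\wedge,\vee,0,1)$ is a bounded lattice, $(L,\otimes,1)$ is a commutative monoid, $x\otimes y\le z$ iff $x\le y\to z$, $x\wedge y=x\otimes(x\to y)$, and $(x\to y)\vee(y\to x)=1$; a BL-chain is a totally ordered BL-algebra. Put $\bar x=x\to0$, $x\oslash y=\bar x\to y$, $x+y=(x\oslash y)\wedge(y\oslash x)$. A BL-chain $C$ is of cancellative type if for all $x,y,z\in C$, $x+y=x+z$ and $x\otimes y=x\otimes z$ imply $y=z$; a BL-algebra is of cancellative type if it is a subdirect product of BL-chains of cancellative type. A good sequence is a sequence $(a_1,a_2,\ldots)$ in $L$ with $a_i+a_{i+1}=a_i$ for all $i$ and $a_r=0$ for large $r$; $M_L$ is the set of good sequences. Sum: $(\mathbf{a}+\mathbf{b})_i=a_i+(a_{i-1}\otimes b_1)+\cdots+(a_1\otimes b_{i-1})+b_i$. -}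

module Defs where

open import Level using (Level; _⊔_) renaming (suc to lsuc)
open import Data.Nat using (ℕ; zero; suc; _∸_; _≤_)
open import Data.List using (List; foldl; map; upTo)
open import Data.Product using (Σ; _×_; ∃)
open import Data.Sum using (_⊎_)
open import Relation.Binary.PropositionalEquality using (_≡_)

record BLAlgebra (ℓ : Level) : Set (lsuc ℓ) where
  infixr 6 _∨_
  infixr 7 _∧_
  infixr 8 _⊗_
  infixr 5 _⇒_
  field
    Carrier : Set ℓ
    _∧_ _∨_ _⊗_ _⇒_ : Carrier → Carrier → Carrier
    0# 1# : Carrier

  _≤L_ : Carrier → Carrier → Set ℓ
  x ≤L y = x ∧ y ≡ x

  field
    ∧-assoc : ∀ x y z → (x ∧ y) ∧ z ≡ x ∧ (y ∧ z)
    ∨-assoc : ∀ x y z → (x ∨ y) ∨ z ≡ x ∨ (y ∨ z)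
    ∧-comm : ∀ x y → x ∧ y ≡ y ∧ x
    ∨-comm : ∀ x y → x ∨ y ≡ y ∨ x
    ∧-absorbs-∨ : ∀ x y → x ∧ (x ∨ y) ≡ x
    ∨-absorbs-∧ : ∀ x y → x ∨ (x ∧ y) ≡ x
    0-least : ∀ x → 0# ≤L x
    1-greatest : ∀ x → x ≤L 1#
    ⊗-assoc : ∀ x y z → (x ⊗ y) ⊗ z ≡ x ⊗ (y ⊗ z)
    ⊗-comm : ∀ x y → x ⊗ y ≡ y ⊗ x
    ⊗-identityʳ : ∀ x → x ⊗ 1# ≡ x
    residuation : ∀ x y z → ((x ⊗ y) ≤L z → x ≤L (y ⇒ z)) × (x ≤L (y ⇒ z) → (x ⊗ y) ≤L z)
    divisibility : ∀ x y → x ∧ y ≡ x ⊗ (x ⇒ y)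
    prelinearity : ∀ x y → (x ⇒ y) ∨ (y ⇒ x) ≡ 1#

  ‾_ : Carrier → Carrier
  ‾ x = x ⇒ 0#

  _⊘_ : Carrier → Carrier → Carrier
  x ⊘ y = (‾ x) ⇒ y

  infixl 6 _+_
  _+_ : Carrier → Carrier → Carrier
  x + y = (x ⊘ y) ∧ (y ⊘ x)

open BLAlgebra public

IsChain : ∀ {ℓ} → BLAlgebra ℓ → Set ℓ
IsChain L = ∀ x y → _≤L_ L x y ⊎ _≤L_ L y x

IsCancellativeChain : ∀ {ℓ} → BLAlgebra ℓ → Set ℓ
IsCancellativeChain L =
  IsChain L ×
  (∀ x y z → _+_ L x y ≡ _+_ L x z → _⊗_ L x y ≡ _⊗_ L x z → y ≡ z)

IsHomomorphism : ∀ {ℓ ℓ'} (L : BLAlgebra ℓ) (C : BLAlgebra ℓ') →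
                 (Carrier L → Carrier C) → Set (ℓ ⊔ ℓ')
IsHomomorphism L C h =
  (∀ x y → h (_∧_ L x y) ≡ _∧_ C (h x) (h y)) ×
  (∀ x y → h (_∨_ L x y) ≡ _∨_ C (h x) (h y)) ×
  (∀ x y → h (_⊗_ L x y) ≡ _⊗_ C (h x) (h y)) ×
  (∀ x y → h (_⇒_ L x y) ≡ _⇒_ C (h x) (h y)) ×
  (h (0# L) ≡ 0# C) ×
  (h (1# L) ≡ 1# C)

record SubdirectRepresentation {ℓ} (i c : Level) (L : BLAlgebra ℓ) : Set (ℓ ⊔ lsuc i ⊔ lsuc c) where
  field
    Index : Set i
    Factor : Index → BLAlgebra c
    embed : Carrier L → (k : Index) → Carrier (Factor k)
    embed-hom : ∀ k → IsHomomorphism L (Factor k) (λ x → embed x k)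
    embed-injective : ∀ x y → (∀ k → embed x k ≡ embed y k) → x ≡ y
    proj-surjective : ∀ k (y : Carrier (Factor k)) → ∃ λ x → embed x k ≡ y

record CancellativeType {ℓ} (i c : Level) (L : BLAlgebra ℓ) : Set (ℓ ⊔ lsuc i ⊔ lsuc c) where
  field
    representation : SubdirectRepresentation i c L
  open SubdirectRepresentation representation public
  field
    factors-cancellative : ∀ k → IsCancellativeChain (Factor k)

-- Sequences are indexed from 0: (s 0, s 1, ...) stands for (a_1, a_2, ...).
Seq : ∀ {ℓ} → BLAlgebra ℓ → Set ℓ
Seq L = ℕ → Carrier L

record GoodSeq {ℓ} (L : BLAlgebra ℓ) : Set ℓ where
  field
    seq : Seq L
    good : ∀ n → _+_ L (seq n) (seq (suc n)) ≡ seq n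
    eventually-0 : ∃ λ r → ∀ n → r ≤ n → seq n ≡ 0# L
open GoodSeq public

-- Sum of sequences: with 0-based index k (= i - 1),
--   (a + b)_k = (...((a_k + a_{k-1}⊗b_0) + a_{k-2}⊗b_1) + ... + a_0⊗b_{k-1}) + b_k
-- (left-nested).
seqSum : ∀ {ℓ} (L : BLAlgebra ℓ) → Seq L → Seq L → Seq L
seqSum L a b k =
  _+_ L (foldl (_+_ L) (a k) (map (λ j → _⊗_ L (a (k ∸ suc j)) (b j)) (upTo k))) (b k)

-- A subdirect representation L ↪ Π_k C_k consists of
-- homomorphisms, and homomorphisms preserve ⊕, the sum of sequences and
-- goodness; since the embedding is injective it suffices to cancel in each
-- factor, i.e. in a BL-chain C of cancellative type.
--
-- In such a chain totality and the cancellation law force x ⊕ y = x to give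
-- x = 1 or y = 0, so every good sequence is a "step" (1,…,1,α,0,0,…) with
-- α at some position m.  In an arbitrary BL-algebra the sum of two steps
-- (1^m,α,0,…) and (1^p,δ,0,…) is computed explicitly: it is
-- (1^{m+p}, α ⊕ δ, α ⊗ δ, 0, …); for this the sum is rewritten as a
-- left-nested ⊕-sum of the convolution terms a'_{k+1-q} ⊗ d'_q, where a', d'
-- are the sequences with a 1 prepended.  Comparing the step shapes of a and b
-- in a + d = b + d then leaves three cases: equal shapes (cancel α against β
-- by the defining law of cancellative type), adjacent shapes (both are the
-- same step) and distant shapes (which force 1 = 0).

module Submission where

open import Defs
  using (BLAlgebra; IsCancellativeChain; IsHomomorphism; CancellativeType;
         GoodSeq; seq; good; eventually-0; seqSum)
open import Level using (Level)
open import Data.Nat using (ℕ; zero; suc; _+_; _∸_; _<_; _≤_; z≤n; s≤s; _≤?_; _<?_)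
open import Data.Nat.Properties
open import Data.List using ([]; _∷_; _++_; foldl; map; upTo; [_])
open import Data.List.Properties using (upTo-∷ʳ; map-++; foldl-++)
open import Data.Product using (_×_; _,_; proj₁; proj₂; ∃)
open import Function using (_∘′_)
open import Data.Sum using (_⊎_; inj₁; inj₂)
open import Relation.Nullary using (yes; no)
open import Relation.Binary using (tri<; tri≈; tri>)
open import Relation.Binary.PropositionalEquality hiding ([_])

module Laws {ℓ : Level} (L : BLAlgebra ℓ) where
  open BLAlgebra L renaming (_+_ to _⊕_; Carrier to X)

  ≤L-refl : ∀ x → x ≤L x
  ≤L-refl x = trans (cong (x ∧_) (sym (∨-absorbs-∧ x x))) (∧-absorbs-∨ x (x ∧ x))

  ≤L-antisym : ∀ {x y} → x ≤L y → y ≤L x → x ≡ y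
  ≤L-antisym {x} {y} x≤y y≤x = trans (sym x≤y) (trans (∧-comm x y) y≤x)

  ∧-greatest : ∀ {z x y} → z ≤L x → z ≤L y → z ≤L (x ∧ y)
  ∧-greatest {z} {x} {y} z≤x z≤y = trans (sym (∧-assoc z x y)) (trans (cong (_∧ y) z≤x) z≤y)

  residual-intro : ∀ {x y z} → (x ⊗ y) ≤L z → x ≤L (y ⇒ z)
  residual-intro {x} {y} {z} = proj₁ (residuation x y z)

  residual-elim : ∀ {x y z} → x ≤L (y ⇒ z) → (x ⊗ y) ≤L z
  residual-elim {x} {y} {z} = proj₂ (residuation x y z)

  ⊗-identityˡ : ∀ x → 1# ⊗ x ≡ x
  ⊗-identityˡ x = trans (⊗-comm 1# x) (⊗-identityʳ x)

  ⊗-zeroˡ : ∀ x → 0# ⊗ x ≡ 0#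
  ⊗-zeroˡ x = ≤L-antisym (residual-elim (0-least (x ⇒ 0#))) (0-least _)

  ⊗-zeroʳ : ∀ x → x ⊗ 0# ≡ 0#
  ⊗-zeroʳ x = trans (⊗-comm x 0#) (⊗-zeroˡ x)

  ⇒-one : ∀ {x y} → x ≤L y → x ⇒ y ≡ 1#
  ⇒-one {x} {y} x≤y =
    ≤L-antisym (1-greatest _) (residual-intro (subst (_≤L y) (sym (⊗-identityˡ x)) x≤y))

  1⇒ : ∀ y → 1# ⇒ y ≡ y
  1⇒ y = ≤L-antisym
    (subst (_≤L y) (⊗-identityʳ (1# ⇒ y)) (residual-elim (≤L-refl _)))
    (residual-intro (subst (_≤L y) (sym (⊗-identityʳ y)) (≤L-refl y)))

  ⊗-≤ʳ : ∀ x y → (x ⊗ y) ≤L y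
  ⊗-≤ʳ x y = residual-elim (subst (x ≤L_) (sym (⇒-one (≤L-refl y))) (1-greatest x))

  ⊗-≤ˡ : ∀ x y → (x ⊗ y) ≤L x
  ⊗-≤ˡ x y = subst (_≤L x) (⊗-comm y x) (⊗-≤ʳ y x)

  ⊗-annihilate : ∀ {y x} → y ≤L (‾ x) → y ⊗ x ≡ 0#
  ⊗-annihilate y≤‾x = ≤L-antisym (residual-elim y≤‾x) (0-least _)

  x⊗‾x : ∀ x → x ⊗ (‾ x) ≡ 0#
  x⊗‾x x = trans (⊗-comm x (‾ x)) (⊗-annihilate (≤L-refl _))

  ≤-‾‾ : ∀ x → x ≤L (‾ (‾ x))
  ≤-‾‾ x = residual-intro (subst (_≤L 0#) (sym (x⊗‾x x)) (≤L-refl 0#))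

  ⊕-comm : ∀ x y → x ⊕ y ≡ y ⊕ x
  ⊕-comm x y = ∧-comm _ _

  ⊕-zeroʳ : ∀ x → x ⊕ 0# ≡ x
  ⊕-zeroʳ x = begin
    ‾ (‾ x) ∧ (‾ 0# ⇒ x)
      ≡⟨ cong (λ t → ‾ (‾ x) ∧ (t ⇒ x)) (⇒-one (≤L-refl 0#)) ⟩
    ‾ (‾ x) ∧ (1# ⇒ x)
      ≡⟨ cong (‾ (‾ x) ∧_) (1⇒ x) ⟩
    ‾ (‾ x) ∧ x
      ≡⟨ ∧-comm _ x ⟩
    x ∧ ‾ (‾ x)
      ≡⟨ ≤-‾‾ x ⟩
    x ∎
    where open ≡-Reasoning

  ⊕-zeroˡ : ∀ x → 0# ⊕ x ≡ x
  ⊕-zeroˡ x = trans (⊕-comm 0# x) (⊕-zeroʳ x)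

  ⊕-oneʳ : ∀ x → x ⊕ 1# ≡ 1#
  ⊕-oneʳ x = begin
    (‾ x ⇒ 1#) ∧ (‾ 1# ⇒ x)
      ≡⟨ cong₂ _∧_ (⇒-one (1-greatest _)) (cong (_⇒ x) (1⇒ 0#)) ⟩
    1# ∧ (0# ⇒ x)
      ≡⟨ cong (1# ∧_) (⇒-one (0-least x)) ⟩
    1# ∧ 1#
      ≡⟨ 1-greatest 1# ⟩
    1# ∎
    where open ≡-Reasoning

  ⊕-oneˡ : ∀ x → 1# ⊕ x ≡ 1#
  ⊕-oneˡ x = trans (⊕-comm 1# x) (⊕-oneʳ x)

  ≤-⊕ʳ : ∀ x y → y ≤L (x ⊕ y)
  ≤-⊕ʳ x y = ∧-greatest (residual-intro (⊗-≤ˡ y (‾ x)))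
                        (residual-intro (subst (_≤L x) (sym (x⊗‾x y)) (0-least x)))

  ⊕-one : ∀ {x y} → (‾ x) ≤L y → (‾ y) ≤L x → x ⊕ y ≡ 1#
  ⊕-one ‾x≤y ‾y≤x = trans (cong₂ _∧_ (⇒-one ‾x≤y) (⇒-one ‾y≤x)) (1-greatest 1#)

  degenerate : 1# ≡ 0# → ∀ x y → x ≡ y
  degenerate 1≡0 x y = trans (to-0 x) (sym (to-0 y))
    where
    to-0 : ∀ z → z ≡ 0#
    to-0 z = ≤L-antisym (subst (z ≤L_) 1≡0 (1-greatest z)) (0-least z)

module Steps {ℓ : Level} (L : BLAlgebra ℓ) where
  open BLAlgebra L renaming (_+_ to _⊕_; Carrier to X)
  open Laws L

  leftSum : (ℕ → X) → ℕ → X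
  leftSum e zero = e zero
  leftSum e (suc N) = leftSum e N ⊕ e (suc N)

  leftSum-one : ∀ e {q} N → q ≤ N → e q ≡ 1# → leftSum e N ≡ 1#
  leftSum-one e zero z≤n eq = eq
  leftSum-one e (suc N) q≤ eq with m≤n⇒m<n∨m≡n q≤
  ... | inj₁ (s≤s q≤N) = trans (cong (_⊕ e (suc N)) (leftSum-one e N q≤N eq)) (⊕-oneˡ _)
  ... | inj₂ refl = trans (cong (leftSum e N ⊕_) eq) (⊕-oneʳ _)

  leftSum-zero : ∀ e N → (∀ q → q ≤ N → e q ≡ 0#) → leftSum e N ≡ 0#
  leftSum-zero e zero zeros = zeros 0 z≤n
  leftSum-zero e (suc N) zeros =
    trans (cong₂ _⊕_ (leftSum-zero e N (λ q q≤N → zeros q (m≤n⇒m≤1+n q≤N))) (zeros (suc N) ≤-refl))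
          (⊕-zeroʳ 0#)

  leftSum-last : ∀ e Q → (∀ q → q < Q → e q ≡ 0#) → leftSum e Q ≡ e Q
  leftSum-last e zero zeros = refl
  leftSum-last e (suc Q) zeros =
    trans (cong (_⊕ e (suc Q)) (leftSum-zero e Q (λ q q≤Q → zeros q (s≤s q≤Q)))) (⊕-zeroˡ _)

  leftSum-stop : ∀ e {Q} N → Q ≤ N → (∀ q → Q < q → e q ≡ 0#) → leftSum e N ≡ leftSum e Q
  leftSum-stop e zero z≤n zeros = refl
  leftSum-stop e (suc N) Q≤ zeros with m≤n⇒m<n∨m≡n Q≤
  ... | inj₂ refl = refl
  ... | inj₁ (s≤s Q≤N) =
    trans (cong₂ _⊕_ (leftSum-stop e N Q≤N zeros) (zeros (suc N) (s≤s Q≤N))) (⊕-zeroʳ _)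

  foldl-leftSum : ∀ x f e N → x ≡ e 0 → (∀ j → j < N → f j ≡ e (suc j)) →
                  foldl _⊕_ x (map f (upTo N)) ≡ leftSum e N
  foldl-leftSum x f e zero x≡e0 _ = x≡e0
  foldl-leftSum x f e (suc N) x≡e0 terms = begin
    foldl _⊕_ x (map f (upTo (suc N)))
      ≡⟨ cong (λ l → foldl _⊕_ x (map f l)) (sym (upTo-∷ʳ N)) ⟩
    foldl _⊕_ x (map f (upTo N ++ [ N ]))
      ≡⟨ cong (foldl _⊕_ x) (map-++ f (upTo N) [ N ]) ⟩
    foldl _⊕_ x (map f (upTo N) ++ [ f N ])
      ≡⟨ foldl-++ _⊕_ x (map f (upTo N)) [ f N ] ⟩
    foldl _⊕_ x (map f (upTo N)) ⊕ f N
      ≡⟨ cong₂ _⊕_ (foldl-leftSum x f e N x≡e0 (λ j j<N → terms j (m≤n⇒m≤1+n j<N))) (terms N ≤-refl) ⟩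
    leftSum e N ⊕ e (suc N) ∎
    where open ≡-Reasoning

  -- The sequence with a 1 prepended (the paper's a_0 = 1 convention).
  pad : (ℕ → X) → ℕ → X
  pad a zero = 1#
  pad a (suc i) = a i

  conv : (ℕ → X) → (ℕ → X) → ℕ → ℕ → X
  conv a d k q = pad a (suc k ∸ q) ⊗ pad d q

  conv-at : ∀ a d k i q → i + q ≡ suc k → conv a d k q ≡ pad a i ⊗ pad d q
  conv-at a d k i q i+q≡ =
    cong (λ t → pad a t ⊗ pad d q) (trans (cong (_∸ q) (sym i+q≡)) (m+n∸n≡m i q))

  seqSum-leftSum : ∀ a d k → seqSum L a d k ≡ leftSum (conv a d k) (suc k)
  seqSum-leftSum a d k = cong₂ _⊕_
    (foldl-leftSum (a k) _ (conv a d k) k (sym (⊗-identityʳ (a k))) middle)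
    (sym (trans (cong (λ t → pad a t ⊗ d k) (n∸n≡0 k)) (⊗-identityˡ (d k))))
    where
    middle : ∀ j → j < k → a (k ∸ suc j) ⊗ d j ≡ conv a d k (suc j)
    middle j j<k = cong (λ t → pad a t ⊗ d j) (sym (+-∸-assoc 1 j<k))

  IsStep : (ℕ → X) → ℕ → Set ℓ
  IsStep a m = (∀ j → j < m → a j ≡ 1#) × (∀ j → m < j → a j ≡ 0#)

  steps-equal : ∀ {a b m} → IsStep a m → IsStep b m → a m ≡ b m → ∀ k → a k ≡ b k
  steps-equal {m = m} (a-ones , a-zeros) (b-ones , b-zeros) eq k with <-cmp k m
  ... | tri< k<m _ _ = trans (a-ones k k<m) (sym (b-ones k k<m))
  ... | tri≈ _ refl _ = eq
  ... | tri> _ _ m<k = trans (a-zeros k m<k) (sym (b-zeros k m<k))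

  step-extend : ∀ {a m} → IsStep a m → a m ≡ 1# → IsStep a (suc m)
  step-extend {a} {m} (ones , zeros) am≡1 = ones′ , λ j sm<j → zeros j (<⇒≤ sm<j)
    where
    ones′ : ∀ j → j < suc m → a j ≡ 1#
    ones′ j (s≤s j≤m) with m≤n⇒m<n∨m≡n j≤m
    ... | inj₁ j<m = ones j j<m
    ... | inj₂ refl = am≡1

  pad-one : ∀ {b n} → IsStep b n → ∀ i → i ≤ n → pad b i ≡ 1#
  pad-one _ zero _ = refl
  pad-one (ones , _) (suc i) i<n = ones i i<n

  pad-zero : ∀ {b n} → IsStep b n → ∀ i → suc n < i → pad b i ≡ 0#
  pad-zero (_ , zeros) (suc i) (s≤s n<i) = zeros i n<i

  module StepSum (a d : ℕ → X) (m p : ℕ) (ra : IsStep a m) (rd : IsStep d p) where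
    s : ℕ → X
    s = seqSum L a d

    zero-a : ∀ k q → suc m + q < suc k → conv a d k q ≡ 0#
    zero-a k q lt = trans (conv-at a d k (suc k ∸ q) q split)
      (trans (cong (_⊗ pad d q) (pad-zero ra _ (+-cancelʳ-< q (suc m) (suc k ∸ q) (subst (suc m + q <_) (sym split) lt))))
             (⊗-zeroˡ _))
      where
      split : (suc k ∸ q) + q ≡ suc k
      split = m∸n+n≡m (<⇒≤ (≤-<-trans (m≤n+m q (suc m)) lt))

    zero-d : ∀ k q → suc p < q → conv a d k q ≡ 0#
    zero-d k q lt = trans (cong (pad a (suc k ∸ q) ⊗_) (pad-zero rd q lt)) (⊗-zeroʳ _)

    sum-below : ∀ k → k < m + p → s k ≡ 1#
    sum-below k k<m+p with suc k ≤? p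
    ... | yes k<p = trans (seqSum-leftSum a d k) (leftSum-one (conv a d k) (suc k) ≤-refl
                      (trans (conv-at a d k 0 (suc k) refl) (trans (⊗-identityˡ _) (pad-one rd (suc k) k<p))))
    ... | no k≮p = trans (seqSum-leftSum a d k) (leftSum-one (conv a d k) (suc k) p≤sk
                      (trans (conv-at a d k i p split)
                        (trans (cong₂ _⊗_ (pad-one ra i i≤m) (pad-one rd p ≤-refl)) (⊗-identityʳ 1#))))
      where
      p≤sk : p ≤ suc k
      p≤sk = <⇒≤ (≰⇒> k≮p)
      i : ℕ
      i = suc k ∸ p
      split : i + p ≡ suc k
      split = m∸n+n≡m p≤sk
      i≤m : i ≤ m
      i≤m = +-cancelʳ-≤ p i m (subst (_≤ m + p) (sym split) k<m+p)

    sum-at : s (m + p) ≡ a m ⊕ d p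
    sum-at = begin
      s (m + p)
        ≡⟨ seqSum-leftSum a d (m + p) ⟩
      leftSum e (suc (m + p))
        ≡⟨ leftSum-stop e (suc (m + p)) (s≤s (m≤n+m p m)) (λ q → zero-d (m + p) q) ⟩
      leftSum e p ⊕ e (suc p)
        ≡⟨ cong (_⊕ e (suc p)) (leftSum-last e p (λ q q<p → zero-a (m + p) q (s≤s (+-monoʳ-< m q<p)))) ⟩
      e p ⊕ e (suc p)
        ≡⟨ cong₂ _⊕_ (conv-at a d (m + p) (suc m) p refl) (conv-at a d (m + p) m (suc p) (+-suc m p)) ⟩
      a m ⊗ pad d p ⊕ pad a m ⊗ d p
        ≡⟨ cong₂ _⊕_ (cong (a m ⊗_) (pad-one rd p ≤-refl)) (cong (_⊗ d p) (pad-one ra m ≤-refl)) ⟩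
      a m ⊗ 1# ⊕ 1# ⊗ d p
        ≡⟨ cong₂ _⊕_ (⊗-identityʳ (a m)) (⊗-identityˡ (d p)) ⟩
      a m ⊕ d p ∎
      where
      open ≡-Reasoning
      e : ℕ → X
      e = conv a d (m + p)

    sum-next : s (suc (m + p)) ≡ a m ⊗ d p
    sum-next = begin
      s k
        ≡⟨ seqSum-leftSum a d k ⟩
      leftSum e (suc k)
        ≡⟨ leftSum-stop e (suc k) (s≤s (m≤n⇒m≤1+n (m≤n+m p m))) (λ q → zero-d k q) ⟩
      leftSum e (suc p)
        ≡⟨ leftSum-last e (suc p) (λ q q≤p → zero-a k q (s≤s (subst (m + q <_) (+-suc m p) (+-monoʳ-< m q≤p)))) ⟩
      e (suc p)
        ≡⟨ conv-at a d k (suc m) (suc p) (cong suc (+-suc m p)) ⟩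
      a m ⊗ d p ∎
      where
      open ≡-Reasoning
      k : ℕ
      k = suc (m + p)
      e : ℕ → X
      e = conv a d k

    sum-above : ∀ k → suc (m + p) < k → s k ≡ 0#
    sum-above k lt = trans (seqSum-leftSum a d k) (leftSum-zero (conv a d k) (suc k) zeros)
      where
      zeros : ∀ q → q ≤ suc k → conv a d k q ≡ 0#
      zeros q _ with suc p <? q
      ... | yes p<q = zero-d k q p<q
      ... | no p≮q = zero-a k q (≤-<-trans (+-monoʳ-≤ (suc m) (≮⇒≥ p≮q))
                       (subst (_< suc k) (sym (cong suc (+-suc m p))) (s≤s lt)))

module CancellativeChain {c : Level} (C : BLAlgebra c) (cancChain : IsCancellativeChain C) where
  open BLAlgebra C renaming (_+_ to _⊕_; Carrier to X)
  open Laws C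
  open Steps C

  cancelʳ : ∀ x y z → y ⊕ x ≡ z ⊕ x → y ⊗ x ≡ z ⊗ x → y ≡ z
  cancelʳ x y z sum≡ prod≡ = proj₂ cancChain x y z
    (trans (⊕-comm x y) (trans sum≡ (⊕-comm z x)))
    (trans (⊗-comm x y) (trans prod≡ (⊗-comm z x)))

  absorbed-zero : ∀ {x y} → x ⊕ y ≡ x → x ⊗ y ≡ 0# → y ≡ 0#
  absorbed-zero {x} {y} x⊕y≡x x⊗y≡0 =
    proj₂ cancChain x y 0# (trans x⊕y≡x (sym (⊕-zeroʳ x))) (trans x⊗y≡0 (sym (⊗-zeroʳ x)))

  -- Key dichotomy for consecutive entries of a good sequence: by totality,
  -- either one of x, y lies below the negation of the other (so x ⊗ y = 0),
  -- or each negation lies below the other element (so x ⊕ y = 1).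
  good-step : ∀ x y → x ⊕ y ≡ x → x ≡ 1# ⊎ y ≡ 0#
  good-step x y x⊕y≡x with proj₁ cancChain y (‾ x)
  ... | inj₁ y≤‾x = inj₂ (absorbed-zero x⊕y≡x (trans (⊗-comm x y) (⊗-annihilate y≤‾x)))
  ... | inj₂ ‾x≤y with proj₁ cancChain (‾ y) x
  ...   | inj₁ ‾y≤x = inj₁ (trans (sym x⊕y≡x) (⊕-one ‾x≤y ‾y≤x))
  ...   | inj₂ x≤‾y = inj₂ (absorbed-zero x⊕y≡x (⊗-annihilate x≤‾y))

  good-is-step : ∀ (a : ℕ → X) → (∀ n → a n ⊕ a (suc n) ≡ a n) →
                 ∀ r → (∀ n → r ≤ n → a n ≡ 0#) → ∃ (IsStep a)
  good-is-step a good-a zero vanish = 0 , (λ _ ()) , λ j _ → vanish j z≤n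
  good-is-step a good-a (suc r) vanish with good-step (a 0) (a 1) (good-a 0)
  ... | inj₁ a0≡1
    with good-is-step (λ n → a (suc n)) (λ n → good-a (suc n)) r (λ n r≤n → vanish (suc n) (s≤s r≤n))
  ...   | m , ones , zeros = suc m , ones′ , λ { (suc j) (s≤s m<j) → zeros j m<j }
    where
    ones′ : ∀ j → j < suc m → a j ≡ 1#
    ones′ zero _ = a0≡1
    ones′ (suc j) (s≤s j<m) = ones j j<m
  good-is-step a good-a (suc r) vanish | inj₂ a1≡0 = 0 , (λ _ ()) , λ { (suc j) _ → tail j }
    where
    tail : ∀ j → a (suc j) ≡ 0#
    tail zero = a1≡0
    tail (suc j) = begin
      a (suc (suc j))
        ≡⟨ sym (⊕-zeroˡ _) ⟩
      0# ⊕ a (suc (suc j))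
        ≡⟨ cong (_⊕ a (suc (suc j))) (sym (tail j)) ⟩
      a (suc j) ⊕ a (suc (suc j))
        ≡⟨ good-a (suc j) ⟩
      a (suc j)
        ≡⟨ tail j ⟩
      0# ∎
      where open ≡-Reasoning

  module Cancel (a b d : ℕ → X) (sums : ∀ k → seqSum C a d k ≡ seqSum C b d k)
                {p : ℕ} (rd : IsStep d p) where

    same-shape : ∀ {m} → IsStep a m → IsStep b m → ∀ k → a k ≡ b k
    same-shape {m} ra rb = steps-equal ra rb (cancelʳ (d p) (a m) (b m)
      (trans (sym A.sum-at) (trans (sums _) B.sum-at))
      (trans (sym A.sum-next) (trans (sums _) B.sum-next)))
      where
      module A = StepSum a d m p ra rd
      module B = StepSum b d m p rb rd

    -- Shapes m and m+1 force α = 1 and β = 0: both are the step 1^{m+1}.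
    adjacent-shape : ∀ {m} → IsStep a m → IsStep b (suc m) → ∀ k → a k ≡ b k
    adjacent-shape {m} ra rb =
      steps-equal (step-extend ra α≡1) rb (trans (proj₂ ra (suc m) ≤-refl) (sym β≡0))
      where
      module A = StepSum a d m p ra rd
      module B = StepSum b d (suc m) p rb rd
      sum-one : a m ⊕ d p ≡ 1#
      sum-one = trans (sym A.sum-at) (trans (sums _) (B.sum-below _ ≤-refl))
      product-sum : a m ⊗ d p ≡ b (suc m) ⊕ d p
      product-sum = trans (sym A.sum-next) (trans (sums _) B.sum-at)
      product-zero : b (suc m) ⊗ d p ≡ 0#
      product-zero = trans (sym B.sum-next) (trans (sym (sums _)) (A.sum-above _ ≤-refl))
      product-d : a m ⊗ d p ≡ d p
      product-d = ≤L-antisym (⊗-≤ʳ _ _) (subst (d p ≤L_) (sym product-sum) (≤-⊕ʳ _ _))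
      α≡1 : a m ≡ 1#
      α≡1 = cancelʳ (d p) _ _ (trans sum-one (sym (⊕-oneˡ _))) (trans product-d (sym (⊗-identityˡ _)))
      β≡0 : b (suc m) ≡ 0#
      β≡0 = cancelʳ (d p) _ _ (trans (sym product-sum) (trans product-d (sym (⊕-zeroˡ _))))
                              (trans product-zero (sym (⊗-zeroˡ _)))

    -- Shapes further apart force δ = 1 and then 1 = 0.
    distant-shape : ∀ {m n} → IsStep a m → IsStep b n → suc (suc m) ≤ n → 1# ≡ 0#
    distant-shape {m} {n} ra rb 2+m≤n =
      trans (sym (B′.sum-below _ lt′)) (trans (sym (sums _)) (A.sum-above _ ≤-refl))
      where
      module A = StepSum a d m p ra rd
      module B = StepSum b d n p rb rd
      α⊗δ≡1 : a m ⊗ d p ≡ 1#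
      α⊗δ≡1 = trans (sym A.sum-next) (trans (sums _) (B.sum-below _ (+-monoˡ-≤ p 2+m≤n)))
      δ≡1 : d p ≡ 1#
      δ≡1 = ≤L-antisym (1-greatest _) (subst (_≤L d p) α⊗δ≡1 (⊗-≤ʳ _ _))
      module B′ = StepSum b d n (suc p) rb (step-extend rd δ≡1)
      lt′ : suc (suc (m + p)) < n + suc p
      lt′ = subst (_≤ n + suc p) (cong (suc ∘′ suc) (+-suc m p)) (+-monoˡ-≤ (suc p) 2+m≤n)

    ordered : ∀ {m} t → IsStep a m → IsStep b (t + m) → ∀ k → a k ≡ b k
    ordered zero ra rb = same-shape ra rb
    ordered (suc zero) ra rb = adjacent-shape ra rb
    ordered {m} (suc (suc t)) ra rb k =
      degenerate (distant-shape ra rb (s≤s (s≤s (m≤n+m m t)))) (a k) (b k)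

  cancel-steps : ∀ a b d → (∀ k → seqSum C a d k ≡ seqSum C b d k) →
                 ∀ {p m n} → IsStep d p → IsStep a m → IsStep b n → ∀ k → a k ≡ b k
  cancel-steps a b d sums {m = m} {n} rd ra rb with ≤-total m n
  ... | inj₁ m≤n = Cancel.ordered a b d sums rd (n ∸ m) ra (subst (IsStep b) (sym (m∸n+n≡m m≤n)) rb)
  ... | inj₂ n≤m = λ k → sym (Cancel.ordered b a d (λ j → sym (sums j)) rd (m ∸ n) rb
                                (subst (IsStep a) (sym (m∸n+n≡m n≤m)) ra) k)

  step-shape : (a : GoodSeq C) → ∃ (IsStep (seq a))
  step-shape a = good-is-step (seq a) (good a) (proj₁ (eventually-0 a)) (proj₂ (eventually-0 a))

  chain-cancel : (a b d : GoodSeq C) → (∀ k → seqSum C (seq a) (seq d) k ≡ seqSum C (seq b) (seq d) k) →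
                 ∀ k → seq a k ≡ seq b k
  chain-cancel a b d sums =
    cancel-steps (seq a) (seq b) (seq d) sums
      (proj₂ (step-shape d)) (proj₂ (step-shape a)) (proj₂ (step-shape b))

module Transfer {ℓ c : Level} (L : BLAlgebra ℓ) (C : BLAlgebra c)
                (h : BLAlgebra.Carrier L → BLAlgebra.Carrier C) (hom : IsHomomorphism L C h) where
  module S = BLAlgebra L
  module T = BLAlgebra C

  h-∧ : ∀ x y → h (x S.∧ y) ≡ h x T.∧ h y
  h-∧ = proj₁ hom

  h-⊗ : ∀ x y → h (x S.⊗ y) ≡ h x T.⊗ h y
  h-⊗ = proj₁ (proj₂ (proj₂ hom))

  h-⇒ : ∀ x y → h (x S.⇒ y) ≡ h x T.⇒ h y
  h-⇒ = proj₁ (proj₂ (proj₂ (proj₂ hom)))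

  h-0 : h S.0# ≡ T.0#
  h-0 = proj₁ (proj₂ (proj₂ (proj₂ (proj₂ hom))))

  h-⊘ : ∀ x y → h (x S.⊘ y) ≡ h x T.⊘ h y
  h-⊘ x y = trans (h-⇒ _ y) (cong (T._⇒ h y) (trans (h-⇒ x S.0#) (cong (h x T.⇒_) h-0)))

  h-⊕ : ∀ x y → h (x S.+ y) ≡ h x T.+ h y
  h-⊕ x y = trans (h-∧ _ _) (cong₂ T._∧_ (h-⊘ x y) (h-⊘ y x))

  foldl-hom : ∀ (f : ℕ → S.Carrier) (g : ℕ → T.Carrier) → (∀ j → h (f j) ≡ g j) →
              ∀ l x → h (foldl S._+_ x (map f l)) ≡ foldl T._+_ (h x) (map g l)
  foldl-hom f g hf [] x = refl
  foldl-hom f g hf (j ∷ l) x = trans (foldl-hom f g hf l (x S.+ f j))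
    (cong (λ t → foldl T._+_ t (map g l)) (trans (h-⊕ x (f j)) (cong (h x T.+_) (hf j))))

  seqSum-hom : ∀ a d k → h (seqSum L a d k) ≡ seqSum C (λ n → h (a n)) (λ n → h (d n)) k
  seqSum-hom a d k = trans (h-⊕ _ _) (cong (T._+ h (d k))
    (foldl-hom _ _ (λ j → h-⊗ (a (k ∸ suc j)) (d j)) (upTo k) (a k)))

  sums-image : ∀ a b d → (∀ k → seqSum L a d k ≡ seqSum L b d k) →
               ∀ k → seqSum C (λ n → h (a n)) (λ n → h (d n)) k ≡ seqSum C (λ n → h (b n)) (λ n → h (d n)) k
  sums-image a b d sums k = trans (sym (seqSum-hom a d k)) (trans (cong h (sums k)) (seqSum-hom b d k))

  good-image : GoodSeq L → GoodSeq C
  good-image a = record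
    { seq = λ n → h (seq a n)
    ; good = λ n → trans (sym (h-⊕ _ _)) (cong h (good a n))
    ; eventually-0 = proj₁ (eventually-0 a) , λ n r≤n → trans (cong h (proj₂ (eventually-0 a) n r≤n)) h-0
    }

proposition5p10 : ∀ {ℓ i c : Level} (L : BLAlgebra ℓ) → CancellativeType i c L →
    (a b d : GoodSeq L) →
    (∀ n → seqSum L (seq a) (seq d) n ≡ seqSum L (seq b) (seq d) n) →
    ∀ n → seq a n ≡ seq b n
proposition5p10 L ct a b d sums n = embed-injective (seq a n) (seq b n) λ k →
  let open Transfer L (Factor k) (λ x → embed x k) (embed-hom k)
  in CancellativeChain.chain-cancel (Factor k) (factors-cancellative k)
       (good-image a) (good-image b) (good-image d) (sums-image (seq a) (seq b) (seq d) sums) n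
  where open CancellativeType ct
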